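{- For all $E\in\mathcal P^e$ and $\rho\in\mathcal O^e$: (1) if $Unl(E)$ must $Unl(\rho)$ then $E$ wfmust $\rho$; and the converse fails, i.e. there exist $E\in\mathcal P^e$, $\rho\in\mathcal O^e$ with $E$ wfmust $\rho$ but not $Unl(E)$ must $Unl(\rho)$; (2) if $Unl(E)$ must $Unl(\rho)$ then $E$ sfmust $\rho$; and the converse fails, i.e. there exist $E\in\mathcal P^e$, $\rho\in\mathcal O^e$ with $E$ sfmust $\rho$ but not $Unl(E)$ must $Unl(\rho)$.
   Context: Unlabeled processes. Let $\mathcal N$ be an infinite set of names and $\omega\notin\mathcal N$ a special success action. Processes $\mathcal P$: $P::=0\mid x(y).P\mid \bar xy.P\mid P\,|\,P\mid(\nu x)P\mid\, !P$; observers $\mathcal O$: the same grammar extended with $\omega.P$. Binders, $fn$, $bn$, $n(\cdot)$ as usual (alpha-conversion assumed; $fn(\omega)=bn(\omega)=\emptyset$). Actions $\mu$: $xy$, $\bar xy$, $\bar x(y)$, $\tau$ (and $\omega$), with $bn(\bar x(y))=\{y\}$, otherwise empty, $fn(xy)=fn(\bar xy)=\{x,y\}$, $fn(\bar x(y))=\{x\}$, $fn(\tau)=\emptyset$. Transitions: Input $x(y).P\xrightarrow{xz}P\{z/y\}$; Output $\bar xy.P\xrightarrow{\bar xy}P$; $\omega.P\xrightarrow{\omega}P$; Open: $P\xrightarrow{\bar xy}P'$, $x\ne y$ imply $(\nu y)P\xrightarrow{\bar x(y)}P'$; Res: $P\xrightarrow{\mu}P'$, $y\notin n(\mu)$ imply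 $(\nu y)P\xrightarrow{\mu}(\nu y)P'$; Par: $P\xrightarrow{\mu}P'$, $bn(\mu)\cap fn(Q)=\emptyset$ imply $P|Q\xrightarrow{\mu}P'|Q$; Com: $P\xrightarrow{xy}P'$, $Q\xrightarrow{\bar xy}Q'$ imply $P|Q\xrightarrow{\tau}P'|Q'$; Close: $P\xrightarrow{xy}P'$, $Q\xrightarrow{\bar x(y)}Q'$, $y\notin fn(P)$ imply $P|Q\xrightarrow{\tau}(\nu y)(P'|Q')$; symmetric versions of Par, Com, Close; Rep: $P\xrightarrow{\mu}P'$ implies $!P\xrightarrow{\mu}P'|!P$. A maximal computation from $T_0$ is an infinite sequence $T_0\xrightarrow{\tau}T_1\xrightarrow{\tau}\cdots$ or a finite one $T_0\xrightarrow{\tau}\cdots\xrightarrow{\tau}T_n$ with no $\tau$-transition from $T_n$. For $P\in\mathcal P$, $o\in\mathcal O$: $P$ must $o$ iff every maximal computation from $P|o$ contains some $T_i$ with $T_i\xrightarrow{\omega}$ ($T\xrightarrow{\mu}$ means $T\xrightarrow{\mu}T'$ for some $T'$). Labeled terms. Labels are pairs $\langle s,n\rangle\in\{0,1\}^*\times\mathbb N$; $s_0\sqsubseteq s_1$ means $s_0$ is a prefix of $s_1$; for label sets, $L_0\,\Re\,L_1$ iff for all $\langle s_0,n_0\rangle\in L_0$, $\langle s_1,n_1\rangle\in L_1$: $s_0\not\sqsubseteq s_1$ and $s_1\not\sqsubseteq s_0$. Ground labeled terms: $E::=0\mid \mu_{\langle s,n\rangle}.E\mid(\nu x)E\mid E\,|\,E\mid\,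 !_{\langle s,n\rangle}P\mid \omega.o$, where $\mu$ is a prefix $x(y)$ or $\bar xy$, $P$ is unlabeled, and $o\in\mathcal O$ is an unlabeled observer. Labeling function: $L_{\langle s,n\rangle}(0)=0$; $L_{\langle s,n\rangle}(\mu.P)=\mu_{\langle s,n\rangle}.L_{\langle s,n+1\rangle}(P)$; $L_{\langle s,n\rangle}(P_0|P_1)=L_{\langle s0,n\rangle}(P_0)|L_{\langle s1,n\rangle}(P_1)$; $L_{\langle s,n\rangle}((\nu x)P)=(\nu x)L_{\langle s,n\rangle}(P)$; $L_{\langle s,n\rangle}(!P)=\,!_{\langle s,n\rangle}P$; $L_{\langle s,n\rangle}(\omega.o)=\omega.o$. $top(0)=lab(0)=top(\omega.o)=lab(\omega.o)=\emptyset$; $top(\mu_v.E)=\{v\}$, $lab(\mu_v.E)=\{v\}\cup lab(E)$; $top,lab$ of $(\nu x)E$ equal those of $E$; $top$, $lab$ of $E_0|E_1$ are unions; $top(!_vP)=lab(!_vP)=\{v\}$. $wf$ is the least predicate with: $wf(0)$; $wf(\omega.o)$; $wf(L_{\langle s,n\rangle}(\mu.P))$ for every prefixed process/observer $\mu.P$ and label; $wf(E_0|E_1)$ if $wf(E_0)$, $wf(E_1)$, $top(E_0)\,\Re\,top(E_1)$; $wf((\nu x)E)$ if $wf(E)$; $wf(!_{\langle s,n\rangle}P)$ for every $P$ and label. $\mathcal P^e$ (resp. $\mathcal O^e$) is the set of well-formed labeled terms built from processes (resp. observers). $Unl$ removes all labels ($Unl(\mu_v.E)=\mu.Unl(E)$,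 $Unl(!_vP)=\,!P$, $Unl(\omega.o)=\omega.o$, homomorphic on $0$, $|$, $\nu$). Labeled transitions use the unlabeled rules with labels ignored (e.g. $x(y)_v.E\xrightarrow{xz}E\{z/y\}$, $\bar xy_v.E\xrightarrow{\bar xy}E$, $\omega.o\xrightarrow{\omega}o$), except replication: if $P\xrightarrow{\mu}P'$ (unlabeled) then $!_{\langle s,n\rangle}P\xrightarrow{\mu}L_{\langle s0,n+1\rangle}(P')\,|\,!_{\langle s1,n+1\rangle}P$. Live labels. $live(v,\mu,S)$ is the least predicate closed under: $live(\langle s,n\rangle,xz,x(y)_{\langle s,n\rangle}.S)$; $live(\langle s,n\rangle,\bar xz,\bar xz_{\langle s,n\rangle}.S)$; Res: $live(v,\mu,S)$, $y\notin n(\mu)$ imply $live(v,\mu,(\nu y)S)$; Open: $live(v,\bar xy,S)$, $x\ne y$ imply $live(v,\bar x(y),(\nu y)S)$; Rep: if $P\xrightarrow{\mu}P'$ then $live(\langle s,n\rangle,\mu,!_{\langle s,n\rangle}P)$; Par: $live(v,\mu,S_0)$, $bn(\mu)\cap fn(S_1)=\emptyset$ imply $live(v,\mu,S_0|S_1)$; Com: $live(v,xy,S_0)$, $live(w,\bar xy,S_1)$ imply $live(v,\tau,S_0|S_1)$ and $live(w,\tau,S_0|S_1)$; Close: $live(v,xy,S_0)$, $live(w,\bar x(y),S_1)$, $y\notin fn(S_0)$ imply $live(v,\tau,(\nu y)(S_0|S_1))$ and $live(w,\tau,(\nu y)(S_0|S_1))$ (together with symmetric versions of Par, Com, Close). $Ll(S)=\{v: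 live(v,\tau,S)\}$. Fair computations. A maximal labeled computation $S_0\xrightarrow{\tau}S_1\xrightarrow{\tau}\cdots$ is weak-fair if for every label $v$ and every index $i$ there is an index $j\ge i$ with $v\notin Ll(S_j)$; strong-fair if for every label $v$ there is an index $i$ with $v\notin Ll(S_j)$ for all indices $j\ge i$ (indices range over the states of the computation). $E$ sfmust $\rho$ (resp. wfmust) iff every strong-fair (resp. weak-fair) computation from $E|\rho$ contains some $S_i$ with $S_i\xrightarrow{\omega}$. -}

module Defs where

open import Data.Nat using (ℕ; zero; suc; _≤_)
open import Data.Bool using (Bool; true; false)
open import Data.List using (List; []; _∷_; _++_; _∷ʳ_)
open import Data.List.Relation.Unary.All using (All)
open import Data.Product using (_×_; _,_; proj₁; ∃; Σ)
open import Data.Unit using (⊤)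
open import Relation.Nullary using (¬_)
open import Relation.Binary.PropositionalEquality using (_≡_)

-- Names are de Bruijn indices (terms are thereby identified up to
-- alpha-conversion, as assumed in the paper).  A binder ((ν x) or the
-- object of an input x(y)) binds index 0 in its body.

Name : Set
Name = ℕ

data Proc : Set where
  𝟘    : Proc
  inp  : Name → Proc → Proc          -- x(y).P  (y = index 0 in P)
  out  : Name → Name → Proc → Proc
  _∥_  : Proc → Proc → Proc
  ν    : Proc → Proc                 -- (ν x)P  (x = index 0 in P)
  bang : Proc → Proc
  ωp   : Proc → Proc                 -- ω.P (observers only)

-- processes: terms without ω
data NoΩ : Proc → Set where
  n-nil  : NoΩ 𝟘
  n-inp  : ∀ {x P} → NoΩ P → NoΩ (inp x P)
  n-out  : ∀ {x y P} → NoΩ P → NoΩ (out x y P)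
  n-par  : ∀ {P Q} → NoΩ P → NoΩ Q → NoΩ (P ∥ Q)
  n-nu   : ∀ {P} → NoΩ P → NoΩ (ν P)
  n-bang : ∀ {P} → NoΩ P → NoΩ (bang P)

ext : (Name → Name) → Name → Name
ext ρ zero    = zero
ext ρ (suc n) = suc (ρ n)

ren : (Name → Name) → Proc → Proc
ren ρ 𝟘           = 𝟘
ren ρ (inp x P)   = inp (ρ x) (ren (ext ρ) P)
ren ρ (out x y P) = out (ρ x) (ρ y) (ren ρ P)
ren ρ (P ∥ Q)     = ren ρ P ∥ ren ρ Q
ren ρ (ν P)       = ν (ren (ext ρ) P)
ren ρ (bang P)    = bang (ren ρ P)
ren ρ (ωp P)      = ωp (ren ρ P)

-- substitution of z for the bound index 0 (P{z/y})
sub0 : Name → Name → Name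
sub0 z zero    = z
sub0 z (suc k) = k

swap01 : Name → Name
swap01 zero          = suc zero
swap01 (suc zero)    = zero
swap01 (suc (suc k)) = suc (suc k)

-- Actions.  boutA x is the bound output x̄(y); the extruded name y is
-- index 0 of the target term.

data Act : Set where
  inA  : Name → Name → Act
  outA : Name → Name → Act
  boutA : Name → Act
  τ    : Act
  ωa   : Act

data FreeAct : Act → Set where
  f-in  : ∀ {x y} → FreeAct (inA x y)
  f-out : ∀ {x y} → FreeAct (outA x y)
  f-τ   : FreeAct τ
  f-ω   : FreeAct ωa

shiftA : Act → Act
shiftA (inA x y)  = inA (suc x) (suc y)
shiftA (outA x y) = outA (suc x) (suc y)
shiftA (boutA x)  = boutA (suc x)
shiftA τ          = τ
shiftA ωa         = ωa

infix 4 _⟶[_]_ _⟶ₗ[_]_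
infixr 6 _∥_ _∣_

data _⟶[_]_ : Proc → Act → Proc → Set where
  s-inp   : ∀ {x z P} → inp x P ⟶[ inA x z ] ren (sub0 z) P
  s-out   : ∀ {x y P} → out x y P ⟶[ outA x y ] P
  s-ω     : ∀ {P} → ωp P ⟶[ ωa ] P
  s-open  : ∀ {x P P'} → P ⟶[ outA (suc x) zero ] P' → ν P ⟶[ boutA x ] P'
  s-res   : ∀ {μ P P'} → FreeAct μ → P ⟶[ shiftA μ ] P' → ν P ⟶[ μ ] ν P'
  s-resb  : ∀ {x P P'} → P ⟶[ boutA (suc x) ] P' → ν P ⟶[ boutA x ] ν (ren swap01 P')
  s-parl  : ∀ {μ P P' Q} → FreeAct μ → P ⟶[ μ ] P' → P ∥ Q ⟶[ μ ] P' ∥ Q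
  s-parlb : ∀ {x P P' Q} → P ⟶[ boutA x ] P' → P ∥ Q ⟶[ boutA x ] P' ∥ ren suc Q
  s-parr  : ∀ {μ P Q Q'} → FreeAct μ → Q ⟶[ μ ] Q' → P ∥ Q ⟶[ μ ] P ∥ Q'
  s-parrb : ∀ {x P Q Q'} → Q ⟶[ boutA x ] Q' → P ∥ Q ⟶[ boutA x ] ren suc P ∥ Q'
  s-coml  : ∀ {x y P P' Q Q'} → P ⟶[ inA x y ] P' → Q ⟶[ outA x y ] Q' → P ∥ Q ⟶[ τ ] P' ∥ Q'
  s-comr  : ∀ {x y P P' Q Q'} → P ⟶[ outA x y ] P' → Q ⟶[ inA x y ] Q' → P ∥ Q ⟶[ τ ] P' ∥ Q'
  s-closel : ∀ {x P P' Q Q'} → ren suc P ⟶[ inA (suc x) zero ] P' → Q ⟶[ boutA x ] Q' →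
             P ∥ Q ⟶[ τ ] ν (P' ∥ Q')
  s-closer : ∀ {x P P' Q Q'} → P ⟶[ boutA x ] P' → ren suc Q ⟶[ inA (suc x) zero ] Q' →
             P ∥ Q ⟶[ τ ] ν (P' ∥ Q')
  s-rep   : ∀ {μ P P'} → FreeAct μ → P ⟶[ μ ] P' → bang P ⟶[ μ ] P' ∥ bang P
  s-repb  : ∀ {x P P'} → P ⟶[ boutA x ] P' → bang P ⟶[ boutA x ] P' ∥ bang (ren suc P)

data Len : Set where
  fin : ℕ → Len     -- finite computation T₀ … Tₙ
  inf : Len

InRange : Len → ℕ → Set
InRange (fin n) i = i ≤ n
InRange inf     i = ⊤

Final : {S : Set} → (S → S → Set) → (ℕ → S) → Len → Set
Final R f (fin n) = ∀ y → ¬ R (f n) y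
Final R f inf     = ⊤

Maximal : {S : Set} → (S → S → Set) → (ℕ → S) → Len → Set
Maximal R f len = (∀ i → InRange len (suc i) → R (f i) (f (suc i))) × Final R f len

_must_ : Proc → Proc → Set
P must o = ∀ (f : ℕ → Proc) (len : Len) → f 0 ≡ (P ∥ o) →
           Maximal (λ T T' → T ⟶[ τ ] T') f len →
           ∃ λ i → InRange len i × ∃ λ T' → f i ⟶[ ωa ] T'

Label : Set
Label = List Bool × ℕ

data _⊑_ : List Bool → List Bool → Set where
  []⊑ : ∀ {t} → [] ⊑ t
  ∷⊑  : ∀ {b s t} → s ⊑ t → (b ∷ s) ⊑ (b ∷ t)

_ℜ_ : List Label → List Label → Set
L₀ ℜ L₁ = All (λ a → All (λ b → ¬ (proj₁ a ⊑ proj₁ b) × ¬ (proj₁ b ⊑ proj₁ a)) L₁) L₀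

data LT : Set where
  lnil  : LT
  linp  : Label → Name → LT → LT
  lout  : Label → Name → Name → LT → LT
  _∣_   : LT → LT → LT
  lν    : LT → LT
  lbang : Label → Proc → LT
  lω    : Proc → LT            -- ω.o with o an unlabeled observer

lren : (Name → Name) → LT → LT
lren ρ lnil          = lnil
lren ρ (linp v x E)  = linp v (ρ x) (lren (ext ρ) E)
lren ρ (lout v x y E) = lout v (ρ x) (ρ y) (lren ρ E)
lren ρ (E ∣ F)       = lren ρ E ∣ lren ρ F
lren ρ (lν E)        = lν (lren (ext ρ) E)
lren ρ (lbang v P)   = lbang v (ren ρ P)
lren ρ (lω o)        = lω (ren ρ o)

Lab : Label → Proc → LT
Lab v       𝟘           = lnil
Lab (s , n) (inp x P)   = linp (s , n) x (Lab (s , suc n) P)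
Lab (s , n) (out x y P) = lout (s , n) x y (Lab (s , suc n) P)
Lab (s , n) (P ∥ Q)     = Lab (s ∷ʳ false , n) P ∣ Lab (s ∷ʳ true , n) Q
Lab v       (ν P)       = lν (Lab v P)
Lab v       (bang P)    = lbang v P
Lab v       (ωp o)      = lω o

top : LT → List Label
top lnil           = []
top (linp v x E)   = v ∷ []
top (lout v x y E) = v ∷ []
top (E ∣ F)        = top E ++ top F
top (lν E)         = top E
top (lbang v P)    = v ∷ []
top (lω o)         = []

data Prefixed : Proc → Set where
  pre-inp : ∀ {x P} → Prefixed (inp x P)
  pre-out : ∀ {x y P} → Prefixed (out x y P)

data WF : LT → Set where
  wf-nil  : WF lnil
  wf-ω    : ∀ o → WF (lω o)
  wf-pre  : ∀ v P → Prefixed P → WF (Lab v P)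
  wf-par  : ∀ {E F} → WF E → WF F → top E ℜ top F → WF (E ∣ F)
  wf-nu   : ∀ {E} → WF E → WF (lν E)
  wf-bang : ∀ v P → WF (lbang v P)

data LNoΩ : LT → Set where
  ln-nil  : LNoΩ lnil
  ln-inp  : ∀ {v x E} → LNoΩ E → LNoΩ (linp v x E)
  ln-out  : ∀ {v x y E} → LNoΩ E → LNoΩ (lout v x y E)
  ln-par  : ∀ {E F} → LNoΩ E → LNoΩ F → LNoΩ (E ∣ F)
  ln-nu   : ∀ {E} → LNoΩ E → LNoΩ (lν E)
  ln-bang : ∀ {v P} → NoΩ P → LNoΩ (lbang v P)

Pe : LT → Set
Pe E = WF E × LNoΩ E

Oe : LT → Set
Oe ρ = WF ρ

Unl : LT → Proc
Unl lnil           = 𝟘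
Unl (linp v x E)   = inp x (Unl E)
Unl (lout v x y E) = out x y (Unl E)
Unl (E ∣ F)        = Unl E ∥ Unl F
Unl (lν E)         = ν (Unl E)
Unl (lbang v P)    = bang P
Unl (lω o)         = ωp o

-- Labeled transitions (for actions other than the ω of ω.o)

data _⟶ₗ[_]_ : LT → Act → LT → Set where
  l-inp   : ∀ {v x z E} → linp v x E ⟶ₗ[ inA x z ] lren (sub0 z) E
  l-out   : ∀ {v x y E} → lout v x y E ⟶ₗ[ outA x y ] E
  l-open  : ∀ {x E E'} → E ⟶ₗ[ outA (suc x) zero ] E' → lν E ⟶ₗ[ boutA x ] E'
  l-res   : ∀ {μ E E'} → FreeAct μ → E ⟶ₗ[ shiftA μ ] E' → lν E ⟶ₗ[ μ ] lν E'
  l-resb  : ∀ {x E E'} → E ⟶ₗ[ boutA (suc x) ] E' → lν E ⟶ₗ[ boutA x ] lν (lren swap01 E')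
  l-parl  : ∀ {μ E E' F} → FreeAct μ → E ⟶ₗ[ μ ] E' → E ∣ F ⟶ₗ[ μ ] E' ∣ F
  l-parlb : ∀ {x E E' F} → E ⟶ₗ[ boutA x ] E' → E ∣ F ⟶ₗ[ boutA x ] E' ∣ lren suc F
  l-parr  : ∀ {μ E F F'} → FreeAct μ → F ⟶ₗ[ μ ] F' → E ∣ F ⟶ₗ[ μ ] E ∣ F'
  l-parrb : ∀ {x E F F'} → F ⟶ₗ[ boutA x ] F' → E ∣ F ⟶ₗ[ boutA x ] lren suc E ∣ F'
  l-coml  : ∀ {x y E E' F F'} → E ⟶ₗ[ inA x y ] E' → F ⟶ₗ[ outA x y ] F' → E ∣ F ⟶ₗ[ τ ] E' ∣ F'
  l-comr  : ∀ {x y E E' F F'} → E ⟶ₗ[ outA x y ] E' → F ⟶ₗ[ inA x y ] F' → E ∣ F ⟶ₗ[ τ ] E' ∣ F'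
  l-closel : ∀ {x E E' F F'} → lren suc E ⟶ₗ[ inA (suc x) zero ] E' → F ⟶ₗ[ boutA x ] F' →
             E ∣ F ⟶ₗ[ τ ] lν (E' ∣ F')
  l-closer : ∀ {x E E' F F'} → E ⟶ₗ[ boutA x ] E' → lren suc F ⟶ₗ[ inA (suc x) zero ] F' →
             E ∣ F ⟶ₗ[ τ ] lν (E' ∣ F')
  l-rep   : ∀ {μ s n P P'} → FreeAct μ → P ⟶[ μ ] P' →
            lbang (s , n) P ⟶ₗ[ μ ] Lab (s ∷ʳ false , suc n) P' ∣ lbang (s ∷ʳ true , suc n) P
  l-repb  : ∀ {x s n P P'} → P ⟶[ boutA x ] P' →
            lbang (s , n) P ⟶ₗ[ boutA x ] Lab (s ∷ʳ false , suc n) P' ∣ lbang (s ∷ʳ true , suc n) (ren suc P)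

-- S —ω→ (success available) for labeled terms
data CanΩ : LT → Set where
  c-ω    : ∀ {o} → CanΩ (lω o)
  c-nu   : ∀ {E} → CanΩ E → CanΩ (lν E)
  c-parl : ∀ {E F} → CanΩ E → CanΩ (E ∣ F)
  c-parr : ∀ {E F} → CanΩ F → CanΩ (E ∣ F)
  c-rep  : ∀ {v P P'} → P ⟶[ ωa ] P' → CanΩ (lbang v P)

data Live : Label → Act → LT → Set where
  lv-inp  : ∀ {v x z S} → Live v (inA x z) (linp v x S)
  lv-out  : ∀ {v x z S} → Live v (outA x z) (lout v x z S)
  lv-res  : ∀ {v μ S} → FreeAct μ → Live v (shiftA μ) S → Live v μ (lν S)
  lv-resb : ∀ {v x S} → Live v (boutA (suc x)) S → Live v (boutA x) (lν S)
  lv-open : ∀ {v x S} → Live v (outA (suc x) zero) S → Live v (boutA x) (lν S)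
  lv-rep  : ∀ {v μ P P'} → P ⟶[ μ ] P' → Live v μ (lbang v P)
  lv-parl : ∀ {v μ S₀ S₁} → Live v μ S₀ → Live v μ (S₀ ∣ S₁)
  lv-parr : ∀ {v μ S₀ S₁} → Live v μ S₁ → Live v μ (S₀ ∣ S₁)
  lv-com₁  : ∀ {v w x y S₀ S₁} → Live v (inA x y) S₀ → Live w (outA x y) S₁ → Live v τ (S₀ ∣ S₁)
  lv-com₂  : ∀ {v w x y S₀ S₁} → Live v (inA x y) S₀ → Live w (outA x y) S₁ → Live w τ (S₀ ∣ S₁)
  lv-com₁' : ∀ {v w x y S₀ S₁} → Live v (outA x y) S₀ → Live w (inA x y) S₁ → Live v τ (S₀ ∣ S₁)
  lv-com₂' : ∀ {v w x y S₀ S₁} → Live v (outA x y) S₀ → Live w (inA x y) S₁ → Live w τ (S₀ ∣ S₁)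
  lv-close₁  : ∀ {v w x S₀ S₁} → Live v (inA (suc x) zero) (lren suc S₀) → Live w (boutA x) S₁ →
               Live v τ (S₀ ∣ S₁)
  lv-close₂  : ∀ {v w x S₀ S₁} → Live v (inA (suc x) zero) (lren suc S₀) → Live w (boutA x) S₁ →
               Live w τ (S₀ ∣ S₁)
  lv-close₁' : ∀ {v w x S₀ S₁} → Live v (boutA x) S₀ → Live w (inA (suc x) zero) (lren suc S₁) →
               Live v τ (S₀ ∣ S₁)
  lv-close₂' : ∀ {v w x S₀ S₁} → Live v (boutA x) S₀ → Live w (inA (suc x) zero) (lren suc S₁) →
               Live w τ (S₀ ∣ S₁)

InLl : Label → LT → Set
InLl v S = Live v τ S

LStepτ : LT → LT → Set
LStepτ S S' = S ⟶ₗ[ τ ] S'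

WeakFair : (ℕ → LT) → Len → Set
WeakFair f len = ∀ (v : Label) (i : ℕ) → InRange len i →
                 ∃ λ j → i ≤ j × InRange len j × ¬ InLl v (f j)

StrongFair : (ℕ → LT) → Len → Set
StrongFair f len = ∀ (v : Label) → ∃ λ i → InRange len i ×
                   (∀ j → i ≤ j → InRange len j → ¬ InLl v (f j))

_wfmust_ : LT → LT → Set
E wfmust ρ = ∀ (f : ℕ → LT) (len : Len) → f 0 ≡ (E ∣ ρ) →
             Maximal LStepτ f len → WeakFair f len →
             ∃ λ i → InRange len i × CanΩ (f i)

_sfmust_ : LT → LT → Set
E sfmust ρ = ∀ (f : ℕ → LT) (len : Len) → f 0 ≡ (E ∣ ρ) →
             Maximal LStepτ f len → StrongFair f len →
             ∃ λ i → InRange len i × CanΩ (f i)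

-- A labeled τ-step erases to an unlabeled τ-step, and conversely every non-ω step of the
-- erasure lifts to a labeled step; so a labeled maximal computation erases to a maximal
-- computation, and success on the erasure is success on the labeled term.  Hence must-testing
-- implies fair must-testing for any notion of fairness.
--
-- For the converse, take E = !(x̄x | x(y)) | ȳy and ρ = y(z).ω.  Unlabeled, the replication
-- can spin forever and ρ is never served.  Labeled, as long as ȳy has not fired its label is
-- live (it can synchronise with ρ), while the replicated part never uses y; so any computation
-- in which that label is ever dead, in particular every weak- or strong-fair one, has reached
-- success.
module Submission where

open import Defs
open import Data.Product using (_×_; ∃; _,_; proj₁; proj₂)
open import Relation.Nullary using (¬_)
open import Data.Nat using (ℕ; zero; suc; z≤n)
open import Data.Nat.Properties using (<⇒≤; ≤-refl; 1+n≢0)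
open import Data.Bool using (false; true)
open import Data.List using ([]; _∷_; _∷ʳ_)
open import Data.List.Relation.Unary.All using ([]; _∷_)
open import Data.Sum using (_⊎_; inj₁; inj₂)
open import Data.Empty using (⊥; ⊥-elim)
open import Data.Unit using (tt)
open import Function using (_∘_)
open import Relation.Binary.PropositionalEquality using (_≡_; _≢_; refl; trans; cong; cong₂; subst)

Unl-lren : ∀ σ E → Unl (lren σ E) ≡ ren σ (Unl E)
Unl-lren σ lnil           = refl
Unl-lren σ (linp v x E)   = cong (inp (σ x)) (Unl-lren (ext σ) E)
Unl-lren σ (lout v x y E) = cong (out (σ x) (σ y)) (Unl-lren σ E)
Unl-lren σ (E ∣ F)        = cong₂ _∥_ (Unl-lren σ E) (Unl-lren σ F)
Unl-lren σ (lν E)         = cong ν (Unl-lren (ext σ) E)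
Unl-lren σ (lbang v P)    = refl
Unl-lren σ (lω o)         = refl

Unl-Lab : ∀ v P → Unl (Lab v P) ≡ P
Unl-Lab v       𝟘           = refl
Unl-Lab (s , n) (inp x P)   = cong (inp x) (Unl-Lab (s , suc n) P)
Unl-Lab (s , n) (out x y P) = cong (out x y) (Unl-Lab (s , suc n) P)
Unl-Lab (s , n) (P ∥ Q)     = cong₂ _∥_ (Unl-Lab _ P) (Unl-Lab _ Q)
Unl-Lab v       (ν P)       = cong ν (Unl-Lab v P)
Unl-Lab v       (bang P)    = refl
Unl-Lab v       (ωp P)      = refl

⟶ₗ⇒⟶ : ∀ {S μ S'} → S ⟶ₗ[ μ ] S' → Unl S ⟶[ μ ] Unl S'
⟶ₗ⇒⟶ (l-inp {z = z} {E = E}) rewrite Unl-lren (sub0 z) E = s-inp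
⟶ₗ⇒⟶ l-out                   = s-out
⟶ₗ⇒⟶ (l-open d)              = s-open (⟶ₗ⇒⟶ d)
⟶ₗ⇒⟶ (l-res fa d)            = s-res fa (⟶ₗ⇒⟶ d)
⟶ₗ⇒⟶ (l-resb {E' = E'} d) rewrite Unl-lren swap01 E' = s-resb (⟶ₗ⇒⟶ d)
⟶ₗ⇒⟶ (l-parl fa d)           = s-parl fa (⟶ₗ⇒⟶ d)
⟶ₗ⇒⟶ (l-parlb {F = F} d) rewrite Unl-lren suc F = s-parlb (⟶ₗ⇒⟶ d)
⟶ₗ⇒⟶ (l-parr fa d)           = s-parr fa (⟶ₗ⇒⟶ d)
⟶ₗ⇒⟶ (l-parrb {E = E} d) rewrite Unl-lren suc E = s-parrb (⟶ₗ⇒⟶ d)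
⟶ₗ⇒⟶ (l-coml d e)            = s-coml (⟶ₗ⇒⟶ d) (⟶ₗ⇒⟶ e)
⟶ₗ⇒⟶ (l-comr d e)            = s-comr (⟶ₗ⇒⟶ d) (⟶ₗ⇒⟶ e)
⟶ₗ⇒⟶ (l-closel {E = E} d e)  = s-closel (subst (_⟶[ _ ] _) (Unl-lren suc E) (⟶ₗ⇒⟶ d)) (⟶ₗ⇒⟶ e)
⟶ₗ⇒⟶ (l-closer {F = F} d e)  = s-closer (⟶ₗ⇒⟶ d) (subst (_⟶[ _ ] _) (Unl-lren suc F) (⟶ₗ⇒⟶ e))
⟶ₗ⇒⟶ (l-rep {s = s} {n} {P' = P'} fa d) rewrite Unl-Lab (s ∷ʳ false , suc n) P' = s-rep fa d
⟶ₗ⇒⟶ (l-repb {s = s} {n} {P' = P'} d)   rewrite Unl-Lab (s ∷ʳ false , suc n) P' = s-repb d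

shiftA-≢ωa : ∀ {μ} → FreeAct μ → μ ≢ ωa → shiftA μ ≢ ωa
shiftA-≢ωa f-in  _   ()
shiftA-≢ωa f-out _   ()
shiftA-≢ωa f-τ   _   ()
shiftA-≢ωa f-ω   μ≢ω _ = μ≢ω refl

-- ω is excluded because ω.o is a labeled atom that fires as CanΩ rather than as ⟶ₗ.  The
-- erasure is passed through an equation so that the recursion, at lren suc S in the Close
-- cases, is structural in the derivation.
⟶⇒⟶ₗ : ∀ S {P μ T} → Unl S ≡ P → μ ≢ ωa → P ⟶[ μ ] T → ∃ λ S' → S ⟶ₗ[ μ ] S'
⟶⇒⟶ₗ (linp v x S)   refl _   s-inp          = _ , l-inp
⟶⇒⟶ₗ (lout v x y S) refl _   s-out          = _ , l-out
⟶⇒⟶ₗ (S₀ ∣ S₁)      refl μ≢ω (s-parl fa d)  = _ , l-parl fa (proj₂ (⟶⇒⟶ₗ S₀ refl μ≢ω d))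
⟶⇒⟶ₗ (S₀ ∣ S₁)      refl _   (s-parlb d)    = _ , l-parlb (proj₂ (⟶⇒⟶ₗ S₀ refl (λ ()) d))
⟶⇒⟶ₗ (S₀ ∣ S₁)      refl μ≢ω (s-parr fa d)  = _ , l-parr fa (proj₂ (⟶⇒⟶ₗ S₁ refl μ≢ω d))
⟶⇒⟶ₗ (S₀ ∣ S₁)      refl _   (s-parrb d)    = _ , l-parrb (proj₂ (⟶⇒⟶ₗ S₁ refl (λ ()) d))
⟶⇒⟶ₗ (S₀ ∣ S₁)      refl _   (s-coml d e)   =
  _ , l-coml (proj₂ (⟶⇒⟶ₗ S₀ refl (λ ()) d))
             (proj₂ (⟶⇒⟶ₗ S₁ refl (λ ()) e))
⟶⇒⟶ₗ (S₀ ∣ S₁)      refl _   (s-comr d e)   =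
  _ , l-comr (proj₂ (⟶⇒⟶ₗ S₀ refl (λ ()) d))
             (proj₂ (⟶⇒⟶ₗ S₁ refl (λ ()) e))
⟶⇒⟶ₗ (S₀ ∣ S₁)      refl _   (s-closel d e) =
  _ , l-closel (proj₂ (⟶⇒⟶ₗ (lren suc S₀) (Unl-lren suc S₀) (λ ()) d))
               (proj₂ (⟶⇒⟶ₗ S₁ refl (λ ()) e))
⟶⇒⟶ₗ (S₀ ∣ S₁)      refl _   (s-closer d e) =
  _ , l-closer (proj₂ (⟶⇒⟶ₗ S₀ refl (λ ()) d))
               (proj₂ (⟶⇒⟶ₗ (lren suc S₁) (Unl-lren suc S₁) (λ ()) e))
⟶⇒⟶ₗ (lν S)         refl _   (s-open d)     = _ , l-open (proj₂ (⟶⇒⟶ₗ S refl (λ ()) d))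
⟶⇒⟶ₗ (lν S)         refl μ≢ω (s-res fa d)   =
  _ , l-res fa (proj₂ (⟶⇒⟶ₗ S refl (shiftA-≢ωa fa μ≢ω) d))
⟶⇒⟶ₗ (lν S)         refl _   (s-resb d)     = _ , l-resb (proj₂ (⟶⇒⟶ₗ S refl (λ ()) d))
⟶⇒⟶ₗ (lbang _ P)    refl _   (s-rep fa d)   = _ , l-rep fa d
⟶⇒⟶ₗ (lbang _ P)    refl _   (s-repb d)     = _ , l-repb d
⟶⇒⟶ₗ (lω o)         refl μ≢ω s-ω            = ⊥-elim (μ≢ω refl)

⟶ω⇒CanΩ : ∀ S {T} → Unl S ⟶[ ωa ] T → CanΩ S
⟶ω⇒CanΩ (S₀ ∣ S₁)   (s-parl _ d) = c-parl (⟶ω⇒CanΩ S₀ d)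
⟶ω⇒CanΩ (S₀ ∣ S₁)   (s-parr _ d) = c-parr (⟶ω⇒CanΩ S₁ d)
⟶ω⇒CanΩ (lν S)      (s-res _ d)  = c-nu (⟶ω⇒CanΩ S d)
⟶ω⇒CanΩ (lbang v P) (s-rep _ d)  = c-rep d
⟶ω⇒CanΩ (lω o)      s-ω          = c-ω

Unl-maximal : ∀ {f len} → Maximal LStepτ f len → Maximal (_⟶[ τ ]_) (Unl ∘ f) len
Unl-maximal {f} {len} (steps , final) = (λ i r → ⟶ₗ⇒⟶ (steps i r)) , Unl-final len final
  where
  Unl-final : ∀ len → Final LStepτ f len → Final (_⟶[ τ ]_) (Unl ∘ f) len
  Unl-final (fin n) final _ d = final _ (proj₂ (⟶⇒⟶ₗ (f n) refl (λ ()) d))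
  Unl-final inf     _         = tt

FairMust : ((ℕ → LT) → Len → Set) → LT → LT → Set
FairMust Fair E ρ = ∀ (f : ℕ → LT) (len : Len) → f 0 ≡ (E ∣ ρ) →
                    Maximal LStepτ f len → Fair f len →
                    ∃ λ i → InRange len i × CanΩ (f i)

must⇒fairMust : ∀ Fair {E ρ} → Unl E must Unl ρ → FairMust Fair E ρ
must⇒fairMust _ must f len f0 maximal _ =
  let i , r , _ , d = must (Unl ∘ f) len (cong Unl f0) (Unl-maximal maximal)
  in  i , r , ⟶ω⇒CanΩ (f i) d

-- Every name occurrence is the index 0, so the only free name is 0: such a process never acts
-- on channel 1, whatever name it receives.
data Only0 : Proc → Set where
  o-nil  : Only0 𝟘
  o-inp  : ∀ {x P} → x ≡ 0 → Only0 P → Only0 (inp x P)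
  o-out  : ∀ {x y P} → x ≡ 0 → y ≡ 0 → Only0 P → Only0 (out x y P)
  o-par  : ∀ {P Q} → Only0 P → Only0 Q → Only0 (P ∥ Q)
  o-bang : ∀ {P} → Only0 P → Only0 (bang P)

Only0-ren : ∀ σ → σ 0 ≡ 0 → ∀ {P} → Only0 P → Only0 (ren σ P)
Only0-ren σ σ0 o-nil         = o-nil
Only0-ren σ σ0 (o-inp x p)   = o-inp (trans (cong σ x) σ0) (Only0-ren (ext σ) refl p)
Only0-ren σ σ0 (o-out x y p) = o-out (trans (cong σ x) σ0) (trans (cong σ y) σ0) (Only0-ren σ σ0 p)
Only0-ren σ σ0 (o-par p q)   = o-par (Only0-ren σ σ0 p) (Only0-ren σ σ0 q)
Only0-ren σ σ0 (o-bang p)    = o-bang (Only0-ren σ σ0 p)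

Only0Step : Act → Proc → Set
Only0Step (inA x y)  T = x ≡ 0 × (y ≡ 0 → Only0 T)
Only0Step (outA x y) T = x ≡ 0 × y ≡ 0 × Only0 T
Only0Step (boutA x)  T = ⊥
Only0Step τ          T = Only0 T
Only0Step ωa         T = ⊥

Only0Step-parˡ : ∀ {μ P Q} → FreeAct μ → Only0Step μ P → Only0 Q → Only0Step μ (P ∥ Q)
Only0Step-parˡ f-in  (x , p)     q = x , λ y → o-par (p y) q
Only0Step-parˡ f-out (x , y , p) q = x , y , o-par p q
Only0Step-parˡ f-τ   p           q = o-par p q

Only0Step-parʳ : ∀ {μ P Q} → FreeAct μ → Only0 P → Only0Step μ Q → Only0Step μ (P ∥ Q)
Only0Step-parʳ f-in  p (x , q)     = x , λ y → o-par p (q y)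
Only0Step-parʳ f-out p (x , y , q) = x , y , o-par p q
Only0Step-parʳ f-τ   p q           = o-par p q

Only0-step : ∀ {P μ T} → Only0 P → P ⟶[ μ ] T → Only0Step μ T
Only0-step (o-inp x p)   (s-inp {z = z})  = x , λ z0 → Only0-ren (sub0 z) z0 p
Only0-step (o-out x y p) s-out            = x , y , p
Only0-step (o-par p q)   (s-parl fa d)    = Only0Step-parˡ fa (Only0-step p d) q
Only0-step (o-par p q)   (s-parlb d)      = ⊥-elim (Only0-step p d)
Only0-step (o-par p q)   (s-parr fa d)    = Only0Step-parʳ fa p (Only0-step q d)
Only0-step (o-par p q)   (s-parrb d)      = ⊥-elim (Only0-step q d)
Only0-step (o-par p q)   (s-coml d e)     with Only0-step p d | Only0-step q e
... | _ , p' | _ , y , q' = o-par (p' y) q'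
Only0-step (o-par p q)   (s-comr d e)     with Only0-step p d | Only0-step q e
... | _ , y , p' | _ , q' = o-par p' (q' y)
Only0-step (o-par p q)   (s-closel d e)   = ⊥-elim (Only0-step q e)
Only0-step (o-par p q)   (s-closer d e)   = ⊥-elim (Only0-step p d)
Only0-step (o-bang p)    (s-rep fa d)     = Only0Step-parˡ fa (Only0-step p d) (o-bang p)
Only0-step (o-bang p)    (s-repb d)       = ⊥-elim (Only0-step p d)

ping : Proc
ping = out 0 0 𝟘 ∥ inp 0 𝟘

Only0-ping : Only0 ping
Only0-ping = o-par (o-out refl refl o-nil) (o-inp refl o-nil)

uL vL wL : Label
uL = false ∷ [] , 0
vL = true ∷ [] , 0
wL = [] , 0

msg tester E₀ : LT
msg    = lout vL 1 1 lnil
tester = linp wL 1 (lω 𝟘)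
E₀     = lbang uL ping ∣ msg

Pe-E₀ : Pe E₀
Pe-E₀ = wf-par (wf-bang uL ping) (wf-pre vL (out 1 1 𝟘) pre-out) ((((λ ()) , (λ ())) ∷ []) ∷ []) ,
        ln-par (ln-bang (n-par (n-out n-nil) (n-inp n-nil))) (ln-out ln-nil)

Oe-tester : Oe tester
Oe-tester = wf-pre wL (inp 1 (ωp 𝟘)) pre-inp

Waiting : LT → Set
Waiting S = ∃ λ X → Only0 (Unl X) × S ≡ (X ∣ msg) ∣ tester

msg-live : ∀ {S} → Waiting S → InLl vL S
msg-live (_ , _ , refl) = lv-com₁' (lv-parr lv-out) lv-inp

Waiting-step : ∀ {X S} → Only0 (Unl X) → (X ∣ msg) ∣ tester ⟶ₗ[ τ ] S → Waiting S ⊎ CanΩ S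
Waiting-step o (l-parl f-τ (l-parl f-τ d))   = inj₁ (_ , Only0-step o (⟶ₗ⇒⟶ d) , refl)
Waiting-step o (l-parl f-τ (l-parr f-τ ()))
Waiting-step o (l-parl f-τ (l-coml d l-out)) = ⊥-elim (1+n≢0 (proj₁ (Only0-step o (⟶ₗ⇒⟶ d))))
Waiting-step o (l-parl f-τ (l-comr d ()))
Waiting-step o (l-parl f-τ (l-closel d ()))
Waiting-step o (l-parl f-τ (l-closer d e))   = ⊥-elim (Only0-step o (⟶ₗ⇒⟶ d))
Waiting-step o (l-parr f-τ ())
Waiting-step o (l-coml d ())
Waiting-step o (l-comr d l-inp)              = inj₂ (c-parr c-ω)
Waiting-step o (l-closel d ())
Waiting-step o (l-closer (l-parlb d) e)      = ⊥-elim (Only0-step o (⟶ₗ⇒⟶ d))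
Waiting-step o (l-closer (l-parrb ()) e)

InRange-pred : ∀ len k → InRange len (suc k) → InRange len k
InRange-pred (fin n) k r = <⇒≤ r
InRange-pred inf     k r = tt

Waiting-or-success : ∀ {f len} → Maximal LStepτ f len → Waiting (f 0) →
                     ∀ k → InRange len k → Waiting (f k) ⊎ ∃ λ i → InRange len i × CanΩ (f i)
Waiting-or-success _ w₀ zero _ = inj₁ w₀
Waiting-or-success {f} {len} maximal w₀ (suc k) r
  with Waiting-or-success maximal w₀ k (InRange-pred len k r)
... | inj₂ success = inj₂ success
... | inj₁ (X , o , fk≡) with Waiting-step o (subst (_⟶ₗ[ τ ] f (suc k)) fk≡ (proj₁ maximal k r))
...   | inj₁ w = inj₁ w
...   | inj₂ c = inj₂ (suc k , r , c)

msg-dead⇒success : ∀ {f len} → Maximal LStepτ f len → f 0 ≡ E₀ ∣ tester →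
                   ∀ j → InRange len j → ¬ InLl vL (f j) → ∃ λ i → InRange len i × CanΩ (f i)
msg-dead⇒success maximal f0 j r dead
  with Waiting-or-success maximal (_ , o-bang Only0-ping , f0) j r
... | inj₁ w       = ⊥-elim (dead (msg-live w))
... | inj₂ success = success

InRange-0 : ∀ len → InRange len 0
InRange-0 (fin n) = z≤n
InRange-0 inf     = tt

E₀-wfmust : E₀ wfmust tester
E₀-wfmust f len f0 maximal fair =
  let j , _ , r , dead = fair vL 0 (InRange-0 len)
  in  msg-dead⇒success maximal f0 j r dead

E₀-sfmust : E₀ sfmust tester
E₀-sfmust f len f0 maximal fair =
  let i , r , dead = fair vL
  in  msg-dead⇒success maximal f0 i r (dead i ≤-refl r)

spin : ℕ → Proc
spin zero    = bang ping
spin (suc k) = (𝟘 ∥ 𝟘) ∥ spin k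

spin-step : ∀ k → spin k ⟶[ τ ] spin (suc k)
spin-step zero    = s-rep f-τ (s-comr s-out s-inp)
spin-step (suc k) = s-parr f-τ (spin-step k)

Only0-spin : ∀ k → Only0 (spin k)
Only0-spin zero    = o-bang Only0-ping
Only0-spin (suc k) = o-par (o-par o-nil o-nil) (Only0-spin k)

E₀-¬must : ¬ (Unl E₀ must Unl tester)
E₀-¬must must with must (λ k → (spin k ∥ out 1 1 𝟘) ∥ inp 1 (ωp 𝟘)) inf refl
                        ((λ k _ → s-parl f-τ (s-parl f-τ (spin-step k))) , tt)
... | i , _ , _ , s-parl _ (s-parl _ d) = Only0-step (Only0-spin i) d
... | _ , _ , _ , s-parl _ (s-parr _ ())
... | _ , _ , _ , s-parr _ ()

proposition6p3 : ((∀ (E ρ : LT) → Pe E → Oe ρ → Unl E must Unl ρ → E wfmust ρ)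
    × (∃ λ E → ∃ λ ρ → Pe E × Oe ρ × E wfmust ρ × ¬ (Unl E must Unl ρ)))
    × ((∀ (E ρ : LT) → Pe E → Oe ρ → Unl E must Unl ρ → E sfmust ρ)
    × (∃ λ E → ∃ λ ρ → Pe E × Oe ρ × E sfmust ρ × ¬ (Unl E must Unl ρ)))
proposition6p3 =
  ((λ _ _ _ _ → must⇒fairMust WeakFair)   , (E₀ , tester , Pe-E₀ , Oe-tester , E₀-wfmust , E₀-¬must)) ,
  ((λ _ _ _ _ → must⇒fairMust StrongFair) , (E₀ , tester , Pe-E₀ , Oe-tester , E₀-sfmust , E₀-¬must))
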